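{- Let $G$ be a connected quartic bicirculant graph having $0$ as a simple eigenvalue. Then the eigenvector corresponding to the eigenvalue $0$ has no zero entries.
   Context: A graph of order $2m$ is a bicirculant if it admits an automorphism with two vertex orbits of equal size $m$; quartic means $4$-regular. Eigenvalues and eigenvectors are those of the adjacency matrix.
   Formalization: Eigenvectors, and the eigenspace of $0$ whose dimension expresses that $0$ is a simple eigenvalue, are taken over the rationals. -}

module Defs where

open import Data.Nat using (ℕ; zero; suc; _<_)
open import Data.Bool using (Bool; true; false; if_then_else_)
open import Data.Fin using (Fin; zero; suc)
open import Data.Fin.Permutation using (Permutation′; _⟨$⟩ʳ_)
open import Data.Rational using (ℚ; 0ℚ; _+_; _*_)
open import Data.Product using (Σ; ∃; ∃-syntax; _×_; _,_)
open import Data.Sum using (_⊎_)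
open import Relation.Binary.PropositionalEquality using (_≡_; _≢_)
open import Relation.Nullary using (¬_)

record Graph (n : ℕ) : Set where
  field
    adj        : Fin n → Fin n → Bool
    symmetric  : ∀ i j → adj i j ≡ adj j i
    irreflexive : ∀ i → adj i i ≡ false
open Graph public

count : ∀ {n} → (Fin n → Bool) → ℕ
count {zero}  f = 0
count {suc n} f = (if f zero then 1 else 0) Data.Nat.+ count (λ j → f (suc j))

sumℚ : ∀ {n} → (Fin n → ℚ) → ℚ
sumℚ {zero}  f = 0ℚ
sumℚ {suc n} f = f zero + sumℚ (λ j → f (suc j))

degree : ∀ {n} → Graph n → Fin n → ℕ
degree G i = count (adj G i)

Quartic : ∀ {n} → Graph n → Set
Quartic G = ∀ i → degree G i ≡ 4

data Walk {n} (G : Graph n) : Fin n → Fin n → Set where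
  here : ∀ {i} → Walk G i i
  step : ∀ {i j k} → adj G i j ≡ true → Walk G j k → Walk G i k

Connected : ∀ {n} → Graph n → Set
Connected G = ∀ i j → Walk G i j

IsAutomorphism : ∀ {n} → Graph n → Permutation′ n → Set
IsAutomorphism G σ = ∀ i j → adj G (σ ⟨$⟩ʳ i) (σ ⟨$⟩ʳ j) ≡ adj G i j

iter : ∀ {n} → Permutation′ n → ℕ → Fin n → Fin n
iter σ zero    i = i
iter σ (suc k) i = σ ⟨$⟩ʳ (iter σ k i)

-- the orbit of u under ⟨σ⟩ has exactly m elements (m = minimal period of u)
OrbitSize : ∀ {n} → Permutation′ n → Fin n → ℕ → Set
OrbitSize σ u m = (0 < m) × (iter σ m u ≡ u) × (∀ k → 0 < k → k < m → iter σ k u ≢ u)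

InOrbit : ∀ {n} → Permutation′ n → Fin n → Fin n → Set
InOrbit σ u w = ∃[ k ] iter σ k u ≡ w

Bicirculant : ∀ {n} → Graph n → Set
Bicirculant {n} G =
  ∃[ m ] (n ≡ 2 Data.Nat.* m) × Σ (Permutation′ n) λ σ → IsAutomorphism G σ ×
    ∃[ u ] ∃[ v ] OrbitSize σ u m × OrbitSize σ v m ×
      ¬ InOrbit σ u v × (∀ w → InOrbit σ u w ⊎ InOrbit σ v w)

applyA : ∀ {n} → Graph n → (Fin n → ℚ) → Fin n → ℚ
applyA G x i = sumℚ (λ j → if adj G i j then x j else 0ℚ)

NonZeroVec : ∀ {n} → (Fin n → ℚ) → Set
NonZeroVec x = ∃[ i ] x i ≢ 0ℚ

Eigenvector0 : ∀ {n} → Graph n → (Fin n → ℚ) → Set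
Eigenvector0 G x = NonZeroVec x × (∀ i → applyA G x i ≡ 0ℚ)

-- 0 is a simple eigenvalue: its eigenspace is one-dimensional
-- (for the symmetric matrix A(G), algebraic = geometric multiplicity).
SimpleEigenvalue0 : ∀ {n} → Graph n → Set
SimpleEigenvalue0 G =
  ∃[ x ] Eigenvector0 G x ×
    (∀ y → (∀ i → applyA G y i ≡ 0ℚ) → ∃[ c ] (∀ i → y i ≡ c * x i))

{-# OPTIONS --safe #-}
module Submission where

-- A kernel vector x spanning the (one-dimensional) kernel is an eigenvector of the automorphism σ,
-- x ∘ σ = l x, and periodicity on an orbit of size m gives l ^ m = 1, so l = ±1.  If x vanished
-- anywhere it would vanish on a whole orbit, say that of u, and take only the values ±c, c = x v,
-- on the orbit of v.  The kernel equation at v balances the neighbours of value c against those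
-- of value -c, so v has 0, 2 or 4 neighbours in its own orbit.
--  * 4: the orbit of v is closed under adjacency, contradicting connectivity.
--  * 2, one of each value: v ~ σˢ v implies v ~ σ^(m-s) v with the same value, so by uniqueness
--    both neighbours are σ^(m/2) v, forcing c = -c.
--  * 0: the graph is bipartite between the two orbits, and transporting x to the other orbit
--    gives a kernel vector that is not a multiple of x.

open import Defs
open import Data.Nat using (ℕ)
open import Data.Fin using (Fin)
open import Data.Rational using (ℚ; 0ℚ)
open import Relation.Binary.PropositionalEquality using (_≢_)

open import Algebra.Bundles using (Monoid; CommutativeMonoid; Ring)
open import Data.Bool using (Bool; true; false; not; _∧_; _∨_; if_then_else_)
open import Data.Bool.Properties using (∧-comm; ∧-assoc; not-involutive)
open import Data.Empty using (⊥; ⊥-elim)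
open import Data.Fin using (zero; suc)
open import Data.Fin.Permutation
  using (Permutation′; _⟨$⟩ʳ_; _⟨$⟩ˡ_; inverseˡ; inverseʳ; permutation)
import Data.Nat as ℕ
open import Data.Nat using (zero; suc; _∸_; s≤s)
import Data.Nat.Properties as ℕ
open import Data.Nat.DivMod using (_%_; _/_; m≡m%n+[m/n]*n; m%n<n)
open import Data.Nat.Divisibility using (_∣_; divides; m%n≡0⇒n∣m)
open import Data.Product using (∃; ∃-syntax; _×_; _,_; proj₁; proj₂)
open import Data.Rational as ℚ using (1ℚ; _+_; _*_; -_; ∣_∣; 1/_; NonNegative)
import Data.Rational.Properties as ℚ
open import Data.Sum as Sum using (_⊎_; inj₁; inj₂)
open import Function using (_∘_)
open import Relation.Binary.Definitions using (tri<; tri≈; tri>)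
open import Relation.Binary.PropositionalEquality
open import Relation.Nullary using (¬_; yes; no; does)
open import Relation.Nullary.Decidable using (dec-true; dec-false)

open import Algebra.Properties.Group ℚ.+-0-group using (∙-cancelˡ)
open import Algebra.Properties.CommutativeSemigroup
  (CommutativeMonoid.commutativeSemigroup ℚ.*-1-commutativeMonoid) using (interchange)
open import Algebra.Properties.Semiring.Exp (Ring.semiring ℚ.+-*-ring) using (_^_)
open import Algebra.Properties.Semiring.Mult (Ring.semiring ℚ.+-*-ring)
  using (×-assoc-*) renaming (_×_ to _×ℚ_)
open import Algebra.Properties.Monoid.Mult ℕ.+-0-monoid using () renaming (_×_ to _×ℕ_)
import Algebra.Properties.Semiring.Sum
import Algebra.Properties.CommutativeMonoid.Sum
module ∑ℚ = Algebra.Properties.Semiring.Sum (Ring.semiring ℚ.+-*-ring)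
module ∑ℕ = Algebra.Properties.CommutativeMonoid.Sum ℕ.+-0-commutativeMonoid

open ≡-Reasoning

InKernel : ∀ {n} → Graph n → (Fin n → ℚ) → Set
InKernel G y = ∀ i → applyA G y i ≡ 0ℚ

SpansKernel : ∀ {n} → Graph n → (Fin n → ℚ) → Set
SpansKernel G x = ∀ y → InKernel G y → ∃[ c ] (∀ i → y i ≡ c * x i)

*-cancelʳ-≢0 : ∀ {p q} r → r ≢ 0ℚ → p * r ≡ q * r → p ≡ q
*-cancelʳ-≢0 {p} {q} r r≢0 pr≡qr = begin
  p                ≡⟨ ℚ.*-identityʳ p ⟨
  p * 1ℚ           ≡⟨ cong (p *_) (ℚ.*-inverseʳ r) ⟨
  p * (r * 1/ r)   ≡⟨ ℚ.*-assoc p r (1/ r) ⟨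
  p * r * 1/ r     ≡⟨ cong (_* 1/ r) pr≡qr ⟩
  q * r * 1/ r     ≡⟨ ℚ.*-assoc q r (1/ r) ⟩
  q * (r * 1/ r)   ≡⟨ cong (q *_) (ℚ.*-inverseʳ r) ⟩
  q * 1ℚ           ≡⟨ ℚ.*-identityʳ q ⟩
  q                ∎
  where instance _ = ℚ.≢-nonZero r≢0

p*q≡0⇒p≡0∨q≡0 : ∀ p q → p * q ≡ 0ℚ → p ≡ 0ℚ ⊎ q ≡ 0ℚ
p*q≡0⇒p≡0∨q≡0 p q pq≡0 with q ℚ.≟ 0ℚ
... | yes q≡0 = inj₂ q≡0
... | no  q≢0 = inj₁ (*-cancelʳ-≢0 q q≢0 (trans pq≡0 (sym (ℚ.*-zeroˡ q))))

p≢0∧q≢0⇒p*q≢0 : ∀ {p q} → p ≢ 0ℚ → q ≢ 0ℚ → p * q ≢ 0ℚ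
p≢0∧q≢0⇒p*q≢0 {p} {q} p≢0 q≢0 pq≡0 with p*q≡0⇒p≡0∨q≡0 p q pq≡0
... | inj₁ p≡0 = p≢0 p≡0
... | inj₂ q≡0 = q≢0 q≡0

p≡-p⇒p≡0 : ∀ {p} → p ≡ - p → p ≡ 0ℚ
p≡-p⇒p≡0 {p} p≡-p with p*q≡0⇒p≡0∨q≡0 (1ℚ + 1ℚ) p 2p≡0
  where
  2p≡0 : (1ℚ + 1ℚ) * p ≡ 0ℚ
  2p≡0 = begin
    (1ℚ + 1ℚ) * p    ≡⟨ ℚ.*-distribʳ-+ p 1ℚ 1ℚ ⟩
    1ℚ * p + 1ℚ * p  ≡⟨ cong₂ _+_ (ℚ.*-identityˡ p) (ℚ.*-identityˡ p) ⟩
    p + p            ≡⟨ cong (p +_) p≡-p ⟩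
    p + - p          ≡⟨ ℚ.+-inverseʳ p ⟩
    0ℚ               ∎
... | inj₂ p≡0 = p≡0

n×ℚ1-nonNeg : ∀ n → 0ℚ ℚ.≤ n ×ℚ 1ℚ
n×ℚ1-nonNeg zero    = ℚ.≤-refl
n×ℚ1-nonNeg (suc n) = ℚ.+-mono-≤ (ℚ.nonNegative⁻¹ 1ℚ) (n×ℚ1-nonNeg n)

n×ℚp≡0⇒p≡0 : ∀ {n p} → n ≢ 0 → n ×ℚ p ≡ 0ℚ → p ≡ 0ℚ
n×ℚp≡0⇒p≡0 {zero}      n≢0 _  = ⊥-elim (n≢0 refl)
n×ℚp≡0⇒p≡0 {suc n} {p} _   eq with p*q≡0⇒p≡0∨q≡0 (suc n ×ℚ 1ℚ) p (begin
  (suc n ×ℚ 1ℚ) * p  ≡⟨ ×-assoc-* (suc n) 1ℚ p ⟩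
  suc n ×ℚ (1ℚ * p)  ≡⟨ cong (suc n ×ℚ_) (ℚ.*-identityˡ p) ⟩
  suc n ×ℚ p         ≡⟨ eq ⟩
  0ℚ                 ∎)
... | inj₂ p≡0   = p≡0
... | inj₁ n+1≡0 =
  ⊥-elim (ℚ.<-irrefl (sym n+1≡0) (ℚ.+-mono-<-≤ (ℚ.positive⁻¹ 1ℚ) (n×ℚ1-nonNeg n)))

×ℚ-cancelʳ-≢0 : ∀ {r} → r ≢ 0ℚ → ∀ a b → a ×ℚ r ≡ b ×ℚ r → a ≡ b
×ℚ-cancelʳ-≢0     r≢0 zero    zero    _  = refl
×ℚ-cancelʳ-≢0     r≢0 zero    (suc b) eq = ⊥-elim (r≢0 (n×ℚp≡0⇒p≡0 {suc b} ℕ.1+n≢0 (sym eq)))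
×ℚ-cancelʳ-≢0     r≢0 (suc a) zero    eq = ⊥-elim (r≢0 (n×ℚp≡0⇒p≡0 {suc a} ℕ.1+n≢0 eq))
×ℚ-cancelʳ-≢0 {r} r≢0 (suc a) (suc b) eq =
  cong suc (×ℚ-cancelʳ-≢0 r≢0 a b (∙-cancelˡ r (a ×ℚ r) (b ×ℚ r) eq))

^-≢0 : ∀ {p} → p ≢ 0ℚ → ∀ k → p ^ k ≢ 0ℚ
^-≢0 p≢0 zero    ()
^-≢0 p≢0 (suc k) = p≢0∧q≢0⇒p*q≢0 p≢0 (^-≢0 p≢0 k)

∣p^k∣≡∣p∣^k : ∀ p k → ∣ p ^ k ∣ ≡ ∣ p ∣ ^ k
∣p^k∣≡∣p∣^k p zero    = refl
∣p^k∣≡∣p∣^k p (suc k) =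
  trans (ℚ.∣p*q∣≡∣p∣*∣q∣ p (p ^ k)) (cong (∣ p ∣ *_) (∣p^k∣≡∣p∣^k p k))

module _ (μ : ℚ) .{{_ : NonNegative μ}} where

  ^-<1 : μ ℚ.< 1ℚ → ∀ k → μ ^ suc k ℚ.< 1ℚ
  ^-<1 μ<1 zero    = subst (ℚ._< 1ℚ) (sym (ℚ.*-identityʳ μ)) μ<1
  ^-<1 μ<1 (suc k) = ℚ.≤-<-trans (ℚ.≤-trans
    (ℚ.*-monoˡ-≤-nonNeg μ (ℚ.<⇒≤ (^-<1 μ<1 k))) (ℚ.≤-reflexive (ℚ.*-identityʳ μ))) μ<1

  ^->1 : 1ℚ ℚ.< μ → ∀ k → 1ℚ ℚ.< μ ^ suc k
  ^->1 1<μ zero    = subst (1ℚ ℚ.<_) (sym (ℚ.*-identityʳ μ)) 1<μ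
  ^->1 1<μ (suc k) = ℚ.<-≤-trans 1<μ (ℚ.≤-trans
    (ℚ.≤-reflexive (sym (ℚ.*-identityʳ μ))) (ℚ.*-monoˡ-≤-nonNeg μ (ℚ.<⇒≤ (^->1 1<μ k))))

  nonNeg-^≡1⇒≡1 : ∀ k → μ ^ suc k ≡ 1ℚ → μ ≡ 1ℚ
  nonNeg-^≡1⇒≡1 k μ^k≡1 with ℚ.<-cmp μ 1ℚ
  ... | tri< μ<1 _ _ = ⊥-elim (ℚ.<-irrefl μ^k≡1 (^-<1 μ<1 k))
  ... | tri≈ _ μ≡1 _ = μ≡1
  ... | tri> _ _ 1<μ = ⊥-elim (ℚ.<-irrefl (sym μ^k≡1) (^->1 1<μ k))

^≡1⇒∣p∣≡1 : ∀ p k → p ^ suc k ≡ 1ℚ → ∣ p ∣ ≡ 1ℚ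
^≡1⇒∣p∣≡1 p k p^k≡1 = nonNeg-^≡1⇒≡1 ∣ p ∣ {{ℚ.∣-∣-nonNeg p}} k (begin
  ∣ p ∣ ^ suc k   ≡⟨ ∣p^k∣≡∣p∣^k p (suc k) ⟨
  ∣ p ^ suc k ∣   ≡⟨ cong ∣_∣ p^k≡1 ⟩
  1ℚ              ∎)

IsSign : ℚ → Set
IsSign p = p ≡ 1ℚ ⊎ p ≡ - 1ℚ

^≡1⇒sign : ∀ p {k} → 0 ℕ.< k → p ^ k ≡ 1ℚ → IsSign p
^≡1⇒sign p {suc k} _ p^k≡1 with ℚ.∣p∣≡p∨∣p∣≡-p p
... | inj₁ ∣p∣≡p  = inj₁ (trans (sym ∣p∣≡p) (^≡1⇒∣p∣≡1 p k p^k≡1))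
... | inj₂ ∣p∣≡-p = inj₂ (ℚ.neg-injective (trans (sym ∣p∣≡-p) (^≡1⇒∣p∣≡1 p k p^k≡1)))

sign-* : ∀ {p q} → IsSign p → IsSign q → IsSign (p * q)
sign-* (inj₁ refl) (inj₁ refl) = inj₁ refl
sign-* (inj₁ refl) (inj₂ refl) = inj₂ refl
sign-* (inj₂ refl) (inj₁ refl) = inj₂ refl
sign-* (inj₂ refl) (inj₂ refl) = inj₁ refl

sign-^ : ∀ {p} → IsSign p → ∀ k → IsSign (p ^ k)
sign-^ s zero    = inj₁ refl
sign-^ s (suc k) = sign-* s (sign-^ s k)

sign*sign≡1 : ∀ {p} → IsSign p → p * p ≡ 1ℚ
sign*sign≡1 (inj₁ refl) = refl
sign*sign≡1 (inj₂ refl) = refl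

sign*p≡±p : ∀ {s} → IsSign s → ∀ p → s * p ≡ p ⊎ s * p ≡ - p
sign*p≡±p (inj₁ refl) p = inj₁ (ℚ.*-identityˡ p)
sign*p≡±p (inj₂ refl) p = inj₂ (trans (sym (ℚ.neg-distribˡ-* 1ℚ p)) (cong -_ (ℚ.*-identityˡ p)))

half-period : ∀ {m s} → 0 ℕ.< s → s ℕ.< m → m ∣ 2 ℕ.* s → 2 ℕ.* s ≡ m
half-period {m} {s} 0<s s<m (divides zero 2s≡0) =
  ⊥-elim (ℕ.<-irrefl (sym (ℕ.m+n≡0⇒m≡0 s 2s≡0)) 0<s)
half-period {m} {s} 0<s s<m (divides 1 2s≡m) = trans 2s≡m (ℕ.+-identityʳ m)
half-period {m} {s} 0<s s<m (divides (suc (suc q)) 2s≡[2+q]m) = ⊥-elim (ℕ.<-irrefl 2s≡[2+q]m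
  (ℕ.<-≤-trans (ℕ.*-monoʳ-< 2 s<m) (ℕ.*-monoˡ-≤ m (ℕ.m≤m+n 2 q))))

sumℚ≡sum : ∀ {n} (f : Fin n → ℚ) → sumℚ f ≡ ∑ℚ.sum f
sumℚ≡sum {zero}  f = refl
sumℚ≡sum {suc n} f = cong (f zero +_) (sumℚ≡sum (f ∘ suc))

module _ {a ℓ} (M : Monoid a ℓ) where
  open Monoid M using (_≈_; ε; ∙-congˡ; identityˡ) renaming (refl to ≈-refl; trans to ≈-trans)
  open import Algebra.Properties.Monoid.Sum M using (sum)
  import Algebra.Properties.Monoid.Mult M as Mult

  sum-if : ∀ {n} (b : Fin n → Bool) x → sum (λ j → if b j then x else ε) ≈ count b Mult.× x
  sum-if {zero}  b x = ≈-refl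
  sum-if {suc n} b x with b zero
  ... | true  = ∙-congˡ (sum-if (b ∘ suc) x)
  ... | false = ≈-trans (identityˡ _) (sum-if (b ∘ suc) x)

toℕ : Bool → ℕ
toℕ b = if b then 1 else 0

count≡sum : ∀ {n} (f : Fin n → Bool) → count f ≡ ∑ℕ.sum (toℕ ∘ f)
count≡sum {zero}  f = refl
count≡sum {suc n} f = cong (toℕ (f zero) ℕ.+_) (count≡sum (f ∘ suc))

count-cong : ∀ {n} {f g : Fin n → Bool} → (∀ j → f j ≡ g j) → count f ≡ count g
count-cong {zero}  f≗g = refl
count-cong {suc n} f≗g = cong₂ (λ b k → toℕ b ℕ.+ k) (f≗g zero) (count-cong (f≗g ∘ suc))

count-permute : ∀ {n} (f : Fin n → Bool) (π : Permutation′ n) →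
                count f ≡ count (f ∘ (π ⟨$⟩ʳ_))
count-permute f π = begin
  count f                        ≡⟨ count≡sum f ⟩
  ∑ℕ.sum (toℕ ∘ f)               ≡⟨ ∑ℕ.∑-permute (toℕ ∘ f) π ⟩
  ∑ℕ.sum (toℕ ∘ f ∘ (π ⟨$⟩ʳ_))   ≡⟨ count≡sum (f ∘ (π ⟨$⟩ʳ_)) ⟨
  count (f ∘ (π ⟨$⟩ʳ_))          ∎

count-+ : ∀ {n} (f g h : Fin n → Bool) → (∀ j → toℕ (f j) ≡ toℕ (g j) ℕ.+ toℕ (h j)) →
          count f ≡ count g ℕ.+ count h
count-+ f g h f≗g+h = begin
  count f                                 ≡⟨ count≡sum f ⟩
  ∑ℕ.sum (toℕ ∘ f)                        ≡⟨ ∑ℕ.sum-cong-≗ f≗g+h ⟩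
  ∑ℕ.sum (λ j → toℕ (g j) ℕ.+ toℕ (h j))  ≡⟨ ∑ℕ.∑-distrib-+ (toℕ ∘ g) (toℕ ∘ h) ⟩
  ∑ℕ.sum (toℕ ∘ g) ℕ.+ ∑ℕ.sum (toℕ ∘ h)   ≡⟨ cong₂ ℕ._+_ (count≡sum g) (count≡sum h) ⟨
  count g ℕ.+ count h                     ∎

count-pos : ∀ {n} (f : Fin n → Bool) {j} → f j ≡ true → count f ≢ 0
count-pos f {zero}  fj≡true count≡0 with f zero
count-pos f {zero}  refl    ()      | true
count-pos f {zero}  ()      _       | false
count-pos f {suc j} fj≡true count≡0 =
  count-pos (f ∘ suc) fj≡true (ℕ.m+n≡0⇒n≡0 (toℕ (f zero)) count≡0)

∧-true : ∀ a b → a ∧ b ≡ true → a ≡ true × b ≡ true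
∧-true true  true  _  = refl , refl
∧-true true  false ()
∧-true false _     ()

count≡0⇒false : ∀ {n} (f : Fin n → Bool) → count f ≡ 0 → ∀ j → f j ≡ false
count≡0⇒false f count≡0 j with f j in fj
... | true  = ⊥-elim (count-pos f fj count≡0)
... | false = refl

count≢0⇒∃ : ∀ {n} (f : Fin n → Bool) → count f ≢ 0 → ∃[ j ] f j ≡ true
count≢0⇒∃ {zero}  f count≢0 = ⊥-elim (count≢0 refl)
count≢0⇒∃ {suc n} f count≢0 with f zero in f0
... | true  = zero , f0
... | false = let j , fj = count≢0⇒∃ (f ∘ suc) count≢0 in suc j , fj

count≡1⇒unique : ∀ {n} (f : Fin n → Bool) → count f ≡ 1 →
                 ∀ {i j} → f i ≡ true → f j ≡ true → i ≡ j
count≡1⇒unique f count≡1 {zero}  {zero}  fi fj = refl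
count≡1⇒unique f count≡1 {zero}  {suc j} fi fj rewrite fi =
  ⊥-elim (count-pos (f ∘ suc) fj (ℕ.suc-injective count≡1))
count≡1⇒unique f count≡1 {suc i} {zero}  fi fj rewrite fj =
  ⊥-elim (count-pos (f ∘ suc) fi (ℕ.suc-injective count≡1))
count≡1⇒unique f count≡1 {suc i} {suc j} fi fj with f zero
... | true  = ⊥-elim (count-pos (f ∘ suc) fj (ℕ.suc-injective count≡1))
... | false = cong suc (count≡1⇒unique (f ∘ suc) count≡1 fi fj)

sum≡0⇒≡0 : ∀ {n} (f : Fin n → ℕ) → ∑ℕ.sum f ≡ 0 → ∀ i → f i ≡ 0
sum≡0⇒≡0 f sum≡0 zero    = ℕ.m+n≡0⇒m≡0 (f zero) sum≡0
sum≡0⇒≡0 f sum≡0 (suc i) = sum≡0⇒≡0 (f ∘ suc) (ℕ.m+n≡0⇒n≡0 (f zero) sum≡0) i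

module _ {n} (G : Graph n) where

  degreeIn : (Fin n → Bool) → Fin n → ℕ
  degreeIn P w = count (λ j → adj G w j ∧ P j)

  Independent : (Fin n → Bool) → Set
  Independent P = ∀ w → P w ≡ true → degreeIn P w ≡ 0

  degreeIn≡0⇒false : ∀ (P : Fin n → Bool) {w j} → degreeIn P w ≡ 0 → adj G w j ≡ true → P j ≡ false
  degreeIn≡0⇒false P {w} {j} degreeIn≡0 wj with count≡0⇒false _ degreeIn≡0 j
  ... | wj∧Pj≡false rewrite wj = wj∧Pj≡false

  degreeIn-∨ : ∀ (P Q : Fin n → Bool) → (∀ j → P j ∧ Q j ≡ false) →
               ∀ w → degreeIn (λ j → P j ∨ Q j) w ≡ degreeIn P w ℕ.+ degreeIn Q w
  degreeIn-∨ P Q disjoint w = count-+ _ _ _ (λ j → split (adj G w j) (P j) (Q j) (disjoint j))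
    where
    split : ∀ a p q → p ∧ q ≡ false → toℕ (a ∧ (p ∨ q)) ≡ toℕ (a ∧ p) ℕ.+ toℕ (a ∧ q)
    split false _     _     _  = refl
    split true  true  true  ()
    split true  true  false _  = refl
    split true  false _     _  = refl

  degreeIn+degreeIn-complement : ∀ (P : Fin n → Bool) w →
                                 degreeIn P w ℕ.+ degreeIn (not ∘ P) w ≡ degree G w
  degreeIn+degreeIn-complement P w = sym (count-+ (adj G w) _ _ (λ j → split (adj G w j) (P j)))
    where
    split : ∀ a b → toℕ a ≡ toℕ (a ∧ b) ℕ.+ toℕ (a ∧ not b)
    split true  true  = refl
    split true  false = refl
    split false _     = refl

  edges : (Fin n → Bool) → (Fin n → Bool) → ℕ
  edges P Q = ∑ℕ.sum (λ w → if P w then degreeIn Q w else 0)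

  edges-comm : ∀ (P Q : Fin n → Bool) → edges P Q ≡ edges Q P
  edges-comm P Q = begin
    edges P Q
      ≡⟨ ∑ℕ.sum-cong-≗ (as-double-sum P Q) ⟩
    ∑ℕ.sum (λ w → ∑ℕ.sum (λ j → toℕ (P w ∧ (adj G w j ∧ Q j))))
      ≡⟨ ∑ℕ.∑-comm (λ w j → toℕ (P w ∧ (adj G w j ∧ Q j))) ⟩
    ∑ℕ.sum (λ j → ∑ℕ.sum (λ w → toℕ (P w ∧ (adj G w j ∧ Q j))))
      ≡⟨ ∑ℕ.sum-cong-≗ (λ j → ∑ℕ.sum-cong-≗ (λ w → cong toℕ (flip w j))) ⟩
    ∑ℕ.sum (λ j → ∑ℕ.sum (λ w → toℕ (Q j ∧ (adj G j w ∧ P w))))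
      ≡⟨ ∑ℕ.sum-cong-≗ (as-double-sum Q P) ⟨
    edges Q P
      ∎
    where
    as-double-sum : ∀ (P Q : Fin n → Bool) w →
                    (if P w then degreeIn Q w else 0) ≡ ∑ℕ.sum (λ j → toℕ (P w ∧ (adj G w j ∧ Q j)))
    as-double-sum P Q w with P w
    ... | true  = count≡sum (λ j → adj G w j ∧ Q j)
    ... | false = sym (∑ℕ.sum-replicate-zero n)
    flip : ∀ w j → P w ∧ (adj G w j ∧ Q j) ≡ Q j ∧ (adj G j w ∧ P w)
    flip w j = begin
      P w ∧ (adj G w j ∧ Q j)  ≡⟨ ∧-comm (P w) _ ⟩
      (adj G w j ∧ Q j) ∧ P w  ≡⟨ cong (_∧ P w) (∧-comm (adj G w j) (Q j)) ⟩
      (Q j ∧ adj G w j) ∧ P w  ≡⟨ ∧-assoc (Q j) _ _ ⟩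
      Q j ∧ (adj G w j ∧ P w)  ≡⟨ cong (λ a → Q j ∧ (a ∧ P w)) (symmetric G w j) ⟩
      Q j ∧ (adj G j w ∧ P w)  ∎

  edges-const : ∀ (P Q : Fin n → Bool) {r} → (∀ w → P w ≡ true → degreeIn Q w ≡ r) →
                edges P Q ≡ count P ×ℕ r
  edges-const P Q {r} const = trans (∑ℕ.sum-cong-≗ pointwise) (sum-if ℕ.+-0-monoid P r)
    where
    pointwise : ∀ w → (if P w then degreeIn Q w else 0) ≡ (if P w then r else 0)
    pointwise w with P w in Pw
    ... | true  = const w Pw
    ... | false = refl

  edges+edges-complement : ∀ (P Q : Fin n → Bool) {r} → (∀ w → degree G w ≡ r) →
                           edges P Q ℕ.+ edges P (not ∘ Q) ≡ count P ×ℕ r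
  edges+edges-complement P Q {r} regular = begin
    edges P Q ℕ.+ edges P (not ∘ Q)
      ≡⟨ ∑ℕ.∑-distrib-+ (into Q) (into (not ∘ Q)) ⟨
    ∑ℕ.sum (λ w → into Q w ℕ.+ into (not ∘ Q) w)
      ≡⟨ ∑ℕ.sum-cong-≗ pointwise ⟩
    ∑ℕ.sum (λ w → if P w then r else 0)
      ≡⟨ sum-if ℕ.+-0-monoid P r ⟩
    count P ×ℕ r
      ∎
    where
    into : (Fin n → Bool) → Fin n → ℕ
    into R w = if P w then degreeIn R w else 0
    pointwise : ∀ w → into Q w ℕ.+ into (not ∘ Q) w ≡ (if P w then r else 0)
    pointwise w with P w
    ... | true  = trans (degreeIn+degreeIn-complement Q w) (regular w)
    ... | false = refl

  -- Double counting the edges between P and its complement.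
  regular-balanced-independent : ∀ {r} (P : Fin n → Bool) → (∀ w → degree G w ≡ r) →
                                 count P ≡ count (not ∘ P) → Independent (not ∘ P) → Independent P
  regular-balanced-independent {r} P regular |P|≡|P̅| P̅-independent w Pw =
    subst (λ b → (if b then degreeIn P w else 0) ≡ 0) Pw (sum≡0⇒≡0 _ edges-P-P≡0 w)
    where
    P̅ = not ∘ P
    degreeIn-P-on-P̅ : ∀ w → P̅ w ≡ true → degreeIn P w ≡ r
    degreeIn-P-on-P̅ w P̅w = begin
      degreeIn P w                     ≡⟨ ℕ.+-identityʳ _ ⟨
      degreeIn P w ℕ.+ 0               ≡⟨ cong (degreeIn P w ℕ.+_) (P̅-independent w P̅w) ⟨
      degreeIn P w ℕ.+ degreeIn P̅ w    ≡⟨ degreeIn+degreeIn-complement P w ⟩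
      degree G w                       ≡⟨ regular w ⟩
      r                                ∎
    edges-P-P≡0 : edges P P ≡ 0
    edges-P-P≡0 = ℕ.+-cancelʳ-≡ (edges P P̅) _ _ (begin
      edges P P ℕ.+ edges P P̅   ≡⟨ edges+edges-complement P P regular ⟩
      count P ×ℕ r              ≡⟨ cong (_×ℕ r) |P|≡|P̅| ⟩
      count P̅ ×ℕ r              ≡⟨ edges-const P̅ P degreeIn-P-on-P̅ ⟨
      edges P̅ P                 ≡⟨ edges-comm P̅ P ⟩
      edges P P̅                 ∎)

  closed-under-walks : (P : Fin n → Set) → (∀ {i j} → adj G i j ≡ true → P i → P j) →
                       ∀ {a b} → Walk G a b → P a → P b
  closed-under-walks P closed here           Pa = Pa
  closed-under-walks P closed (step ij walk) Pa = closed-under-walks P closed walk (closed ij Pa)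

  applyA≡sum : ∀ x i → applyA G x i ≡ ∑ℚ.sum (λ j → if adj G i j then x j else 0ℚ)
  applyA≡sum x i = sumℚ≡sum (λ j → if adj G i j then x j else 0ℚ)

  applyA-cong : ∀ {x y} → (∀ j → x j ≡ y j) → ∀ i → applyA G x i ≡ applyA G y i
  applyA-cong {x} {y} x≗y i = trans (applyA≡sum x i)
    (trans (∑ℚ.sum-cong-≗ (λ j → cong (if adj G i j then_else 0ℚ) (x≗y j))) (sym (applyA≡sum y i)))

  applyA-* : ∀ p x i → applyA G (λ j → p * x j) i ≡ p * applyA G x i
  applyA-* p x i = begin
    applyA G (λ j → p * x j) i                         ≡⟨ applyA≡sum (λ j → p * x j) i ⟩
    ∑ℚ.sum (λ j → if adj G i j then p * x j else 0ℚ)   ≡⟨ ∑ℚ.sum-cong-≗ (λ j → pull (adj G i j) (x j)) ⟩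
    ∑ℚ.sum (λ j → p * row j)                           ≡⟨ ∑ℚ.*-distribˡ-sum p row ⟨
    p * ∑ℚ.sum row                                     ≡⟨ cong (p *_) (applyA≡sum x i) ⟨
    p * applyA G x i                                   ∎
    where
    row : Fin n → ℚ
    row j = if adj G i j then x j else 0ℚ
    pull : ∀ b q → (if b then p * q else 0ℚ) ≡ p * (if b then q else 0ℚ)
    pull true  q = refl
    pull false q = sym (ℚ.*-zeroʳ p)

  applyA-self-adjoint : ∀ x y →
                        ∑ℚ.sum (λ i → applyA G x i * y i) ≡ ∑ℚ.sum (λ i → x i * applyA G y i)
  applyA-self-adjoint x y = begin
    ∑ℚ.sum (λ i → applyA G x i * y i)              ≡⟨ ∑ℚ.sum-cong-≗ expandˡ ⟩
    ∑ℚ.sum (λ i → ∑ℚ.sum (λ j → row x i j * y i))  ≡⟨ ∑ℚ.∑-comm (λ i j → row x i j * y i) ⟩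
    ∑ℚ.sum (λ j → ∑ℚ.sum (λ i → row x i j * y i))  ≡⟨ ∑ℚ.sum-cong-≗ (λ j → ∑ℚ.sum-cong-≗ (transpose j)) ⟩
    ∑ℚ.sum (λ j → ∑ℚ.sum (λ i → x j * row y j i))  ≡⟨ ∑ℚ.sum-cong-≗ expandʳ ⟨
    ∑ℚ.sum (λ j → x j * applyA G y j)              ∎
    where
    row : (Fin n → ℚ) → Fin n → Fin n → ℚ
    row z i j = if adj G i j then z j else 0ℚ
    expandˡ : ∀ i → applyA G x i * y i ≡ ∑ℚ.sum (λ j → row x i j * y i)
    expandˡ i = trans (cong (_* y i) (applyA≡sum x i)) (∑ℚ.*-distribʳ-sum (y i) (row x i))
    expandʳ : ∀ j → x j * applyA G y j ≡ ∑ℚ.sum (λ i → x j * row y j i)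
    expandʳ j = trans (cong (x j *_) (applyA≡sum y j)) (∑ℚ.*-distribˡ-sum (x j) (row y j))
    transpose : ∀ j i → row x i j * y i ≡ x j * row y j i
    transpose j i rewrite symmetric G i j with adj G j i
    ... | true  = refl
    ... | false = trans (ℚ.*-zeroˡ (y i)) (sym (ℚ.*-zeroʳ (x j)))

module _ {n} (σ : Permutation′ n) where

  iter-+ : ∀ a b w → iter σ (a ℕ.+ b) w ≡ iter σ a (iter σ b w)
  iter-+ zero    b w = refl
  iter-+ (suc a) b w = cong (σ ⟨$⟩ʳ_) (iter-+ a b w)

  iter-invariant : ∀ {A : Set} (f : Fin n → A) → (∀ w → f (σ ⟨$⟩ʳ w) ≡ f w) →
                   ∀ k w → f (iter σ k w) ≡ f w
  iter-invariant f inv zero    w = refl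
  iter-invariant f inv (suc k) w = trans (inv (iter σ k w)) (iter-invariant f inv k w)

  iter-eigen : ∀ (f : Fin n → ℚ) p → (∀ w → f (σ ⟨$⟩ʳ w) ≡ p * f w) →
               ∀ k w → f (iter σ k w) ≡ p ^ k * f w
  iter-eigen f p eig zero    w = sym (ℚ.*-identityˡ (f w))
  iter-eigen f p eig (suc k) w = begin
    f (σ ⟨$⟩ʳ iter σ k w)  ≡⟨ eig (iter σ k w) ⟩
    p * f (iter σ k w)     ≡⟨ cong (p *_) (iter-eigen f p eig k w) ⟩
    p * (p ^ k * f w)      ≡⟨ ℚ.*-assoc p (p ^ k) (f w) ⟨
    p ^ suc k * f w        ∎

  iter-eigen-≡0 : ∀ (f : Fin n → ℚ) p → (∀ w → f (σ ⟨$⟩ʳ w) ≡ p * f w) →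
                  ∀ k {w} → f w ≡ 0ℚ → f (iter σ k w) ≡ 0ℚ
  iter-eigen-≡0 f p eig k {w} fw≡0 =
    trans (iter-eigen f p eig k w) (trans (cong (p ^ k *_) fw≡0) (ℚ.*-zeroʳ (p ^ k)))

  iter-eigen-≡0⁻¹ : ∀ (f : Fin n → ℚ) {p} → p ≢ 0ℚ → (∀ w → f (σ ⟨$⟩ʳ w) ≡ p * f w) →
                    ∀ k {w} → f (iter σ k w) ≡ 0ℚ → f w ≡ 0ℚ
  iter-eigen-≡0⁻¹ f {p} p≢0 eig k {w} f[σᵏw]≡0
    with p*q≡0⇒p≡0∨q≡0 (p ^ k) (f w) (trans (sym (iter-eigen f p eig k w)) f[σᵏw]≡0)
  ... | inj₁ pᵏ≡0 = ⊥-elim (^-≢0 p≢0 k pᵏ≡0)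
  ... | inj₂ fw≡0 = fw≡0

  iter-injective : ∀ k {a b} → iter σ k a ≡ iter σ k b → a ≡ b
  iter-injective zero    eq = eq
  iter-injective (suc k) {a} {b} eq = iter-injective k (begin
    iter σ k a                    ≡⟨ inverseˡ σ ⟨
    σ ⟨$⟩ˡ (σ ⟨$⟩ʳ iter σ k a)    ≡⟨ cong (σ ⟨$⟩ˡ_) eq ⟩
    σ ⟨$⟩ˡ (σ ⟨$⟩ʳ iter σ k b)    ≡⟨ inverseˡ σ ⟩
    iter σ k b                    ∎)

  iter-multiple : ∀ {m w} → iter σ m w ≡ w → ∀ q → iter σ (q ℕ.* m) w ≡ w
  iter-multiple         e zero    = refl
  iter-multiple {m} {w} e (suc q) =
    trans (iter-+ m (q ℕ.* m) w) (trans (cong (iter σ m) (iter-multiple e q)) e)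

  ∣⇒iter≡ : ∀ {m w k} → iter σ m w ≡ w → m ∣ k → iter σ k w ≡ w
  ∣⇒iter≡ e (divides q refl) = iter-multiple e q

  iter-% : ∀ {m w} .{{_ : ℕ.NonZero m}} → iter σ m w ≡ w → ∀ k → iter σ (k % m) w ≡ iter σ k w
  iter-% {m} {w} e k = begin
    iter σ (k % m) w                         ≡⟨ cong (iter σ (k % m)) (iter-multiple e (k / m)) ⟨
    iter σ (k % m) (iter σ (k / m ℕ.* m) w)  ≡⟨ iter-+ (k % m) (k / m ℕ.* m) w ⟨
    iter σ (k % m ℕ.+ k / m ℕ.* m) w         ≡⟨ cong (λ t → iter σ t w) (m≡m%n+[m/n]*n k m) ⟨
    iter σ k w                               ∎

  orbitSize-∣ : ∀ {m w} → OrbitSize σ w m → ∀ {k} → iter σ k w ≡ w → m ∣ k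
  orbitSize-∣ {m} {w} (m>0 , e , minimal) {k} ek = m%n≡0⇒n∣m k m k%m≡0
    where
    instance _ = ℕ.>-nonZero m>0
    k%m≡0 : k % m ≡ 0
    k%m≡0 with k % m ℕ.≟ 0
    ... | yes k%m≡0 = k%m≡0
    ... | no  k%m≢0 =
      ⊥-elim (minimal (k % m) (ℕ.n≢0⇒n>0 k%m≢0) (m%n<n k m) (trans (iter-% e k) ek))

  InOrbit-trans : ∀ {a b c} → InOrbit σ a b → InOrbit σ b c → InOrbit σ a c
  InOrbit-trans {a} (j , a→b) (k , b→c) =
    k ℕ.+ j , trans (iter-+ k j a) (trans (cong (iter σ k) a→b) b→c)

  InOrbit-sym : ∀ {m a b} → OrbitSize σ a m → InOrbit σ a b → InOrbit σ b a
  InOrbit-sym {m} {a} {b} (m>0 , e , _) (k , a→b) = k ℕ.* m ∸ k , (begin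
    iter σ (k ℕ.* m ∸ k) b             ≡⟨ cong (iter σ (k ℕ.* m ∸ k)) a→b ⟨
    iter σ (k ℕ.* m ∸ k) (iter σ k a)  ≡⟨ iter-+ (k ℕ.* m ∸ k) k a ⟨
    iter σ (k ℕ.* m ∸ k ℕ.+ k) a       ≡⟨ cong (λ t → iter σ t a) (ℕ.m∸n+n≡m (ℕ.m≤m*n k m)) ⟩
    iter σ (k ℕ.* m) a                 ≡⟨ iter-multiple e k ⟩
    a                                  ∎)
    where instance _ = ℕ.>-nonZero m>0

  shift-transfer-≤ : ∀ {m a b} → OrbitSize σ a m → iter σ m b ≡ b → ∀ {k k'} → k ℕ.≤ k' →
                     iter σ k a ≡ iter σ k' a → iter σ k b ≡ iter σ k' b
  shift-transfer-≤ {m} {a} {b} orbit-a b-periodic {k} {k'} k≤k' eq = begin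
    iter σ k b             ≡⟨ cong (iter σ k) (∣⇒iter≡ b-periodic (orbitSize-∣ orbit-a {d} a-periodic)) ⟨
    iter σ k (iter σ d b)  ≡⟨ iter-+ k d b ⟨
    iter σ (k ℕ.+ d) b     ≡⟨ cong (λ t → iter σ t b) k+d≡k' ⟩
    iter σ k' b            ∎
    where
    d = k' ∸ k
    k+d≡k' = ℕ.m+[n∸m]≡n k≤k'
    a-periodic : iter σ d a ≡ a
    a-periodic = iter-injective k (begin
      iter σ k (iter σ d a)  ≡⟨ iter-+ k d a ⟨
      iter σ (k ℕ.+ d) a     ≡⟨ cong (λ t → iter σ t a) k+d≡k' ⟩
      iter σ k' a            ≡⟨ eq ⟨
      iter σ k a             ∎)

  shift-transfer : ∀ {m a b} → OrbitSize σ a m → iter σ m b ≡ b →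
                   ∀ {k k'} → iter σ k a ≡ iter σ k' a → iter σ k b ≡ iter σ k' b
  shift-transfer orbit-a b-periodic {k} {k'} eq with ℕ.≤-total k k'
  ... | inj₁ k≤k' = shift-transfer-≤ orbit-a b-periodic k≤k' eq
  ... | inj₂ k'≤k = sym (shift-transfer-≤ orbit-a b-periodic k'≤k (sym eq))

record TwoOrbits {n} (σ : Permutation′ n) (m : ℕ) (u v : Fin n) : Set where
  field
    orbit-u  : OrbitSize σ u m
    orbit-v  : OrbitSize σ v m
    disjoint : ¬ InOrbit σ u v
    cover    : ∀ w → InOrbit σ u w ⊎ InOrbit σ v w

  not-both : ∀ {w} → InOrbit σ u w → InOrbit σ v w → ⊥
  not-both u→w v→w = disjoint (InOrbit-trans σ u→w (InOrbit-sym σ orbit-v v→w))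

  flip : TwoOrbits σ m v u
  flip = record
    { orbit-u  = orbit-v
    ; orbit-v  = orbit-u
    ; disjoint = disjoint ∘ InOrbit-sym σ orbit-v
    ; cover    = Sum.swap ∘ cover
    }

  swap-fun : Fin n → Fin n
  swap-fun w with cover w
  ... | inj₁ (k , _) = iter σ k v
  ... | inj₂ (k , _) = iter σ k u

  swap-u : ∀ k → swap-fun (iter σ k u) ≡ iter σ k v
  swap-u k with cover (iter σ k u)
  ... | inj₁ (k' , e) = shift-transfer σ orbit-u (proj₁ (proj₂ orbit-v)) {k'} {k} e
  ... | inj₂ (k' , e) = ⊥-elim (not-both (k , refl) (k' , e))

  swap-v : ∀ k → swap-fun (iter σ k v) ≡ iter σ k u
  swap-v k with cover (iter σ k v)
  ... | inj₁ (k' , e) = ⊥-elim (not-both (k' , e) (k , refl))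
  ... | inj₂ (k' , e) = shift-transfer σ orbit-v (proj₁ (proj₂ orbit-u)) {k'} {k} e

  swap-involutive : ∀ w → swap-fun (swap-fun w) ≡ w
  swap-involutive w with cover w
  ... | inj₁ (k , u→w) = trans (swap-v k) u→w
  ... | inj₂ (k , v→w) = trans (swap-u k) v→w

  swap : Permutation′ n
  swap = permutation swap-fun swap-fun swap-involutive swap-involutive

  swap-σ : ∀ w → swap-fun (σ ⟨$⟩ʳ w) ≡ σ ⟨$⟩ʳ swap-fun w
  swap-σ w with cover w
  ... | inj₁ (k , u→w) = trans (cong (swap-fun ∘ (σ ⟨$⟩ʳ_)) (sym u→w)) (swap-u (suc k))
  ... | inj₂ (k , v→w) = trans (cong (swap-fun ∘ (σ ⟨$⟩ʳ_)) (sym v→w)) (swap-v (suc k))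

module _ {n} (G : Graph n) (σ : Permutation′ n) (σ-aut : IsAutomorphism G σ) where

  adj-iter : ∀ k a b → adj G (iter σ k a) (iter σ k b) ≡ adj G a b
  adj-iter zero    a b = refl
  adj-iter (suc k) a b = trans (σ-aut (iter σ k a) (iter σ k b)) (adj-iter k a b)

  degreeIn-σ : ∀ (P : Fin n → Bool) → (∀ j → P (σ ⟨$⟩ʳ j) ≡ P j) →
               ∀ w → degreeIn G P (σ ⟨$⟩ʳ w) ≡ degreeIn G P w
  degreeIn-σ P P-invariant w = trans (count-permute _ σ)
    (count-cong (λ j → cong₂ _∧_ (σ-aut w j) (P-invariant j)))

  applyA-∘σ : ∀ x i → applyA G (x ∘ (σ ⟨$⟩ʳ_)) i ≡ applyA G x (σ ⟨$⟩ʳ i)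
  applyA-∘σ x i = begin
    applyA G (x ∘ (σ ⟨$⟩ʳ_)) i
      ≡⟨ applyA≡sum G (x ∘ (σ ⟨$⟩ʳ_)) i ⟩
    ∑ℚ.sum (λ j → if adj G i j then x (σ ⟨$⟩ʳ j) else 0ℚ)
      ≡⟨ ∑ℚ.sum-cong-≗ (λ j → cong (if_then x (σ ⟨$⟩ʳ j) else 0ℚ) (σ-aut i j)) ⟨
    ∑ℚ.sum (λ j → if adj G (σ ⟨$⟩ʳ i) (σ ⟨$⟩ʳ j) then x (σ ⟨$⟩ʳ j) else 0ℚ)
      ≡⟨ ∑ℚ.∑-permute (λ j → if adj G (σ ⟨$⟩ʳ i) j then x j else 0ℚ) σ ⟨
    ∑ℚ.sum (λ j → if adj G (σ ⟨$⟩ʳ i) j then x j else 0ℚ)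
      ≡⟨ applyA≡sum G x (σ ⟨$⟩ʳ i) ⟨
    applyA G x (σ ⟨$⟩ʳ i)
      ∎

  applyA-eigen : ∀ x p → (∀ j → x (σ ⟨$⟩ʳ j) ≡ p * x j) →
                 ∀ i → applyA G x (σ ⟨$⟩ʳ i) ≡ p * applyA G x i
  applyA-eigen x p x-eigen i = begin
    applyA G x (σ ⟨$⟩ʳ i)       ≡⟨ applyA-∘σ x i ⟨
    applyA G (x ∘ (σ ⟨$⟩ʳ_)) i  ≡⟨ applyA-cong G x-eigen i ⟩
    applyA G (λ j → p * x j) i  ≡⟨ applyA-* G p x i ⟩
    p * applyA G x i            ∎

  spansKernel⇒σ-eigen : ∀ x → Eigenvector0 G x → SpansKernel G x →
                        ∃[ l ] l ≢ 0ℚ × (∀ i → x (σ ⟨$⟩ʳ i) ≡ l * x i)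
  spansKernel⇒σ-eigen x ((i₀ , xi₀≢0) , x-kernel) simple = l , l≢0 , x∘σ≡l*x
    where
    x∘σ-kernel : InKernel G (x ∘ (σ ⟨$⟩ʳ_))
    x∘σ-kernel i = trans (applyA-∘σ x i) (x-kernel (σ ⟨$⟩ʳ i))
    l = proj₁ (simple (x ∘ (σ ⟨$⟩ʳ_)) x∘σ-kernel)
    x∘σ≡l*x = proj₂ (simple (x ∘ (σ ⟨$⟩ʳ_)) x∘σ-kernel)
    l≢0 : l ≢ 0ℚ
    l≢0 l≡0 = xi₀≢0 (begin
      x i₀                    ≡⟨ cong x (inverseʳ σ) ⟨
      x (σ ⟨$⟩ʳ (σ ⟨$⟩ˡ i₀))  ≡⟨ x∘σ≡l*x (σ ⟨$⟩ˡ i₀) ⟩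
      l * x (σ ⟨$⟩ˡ i₀)       ≡⟨ cong (_* x (σ ⟨$⟩ˡ i₀)) l≡0 ⟩
      0ℚ * x (σ ⟨$⟩ˡ i₀)      ≡⟨ ℚ.*-zeroˡ (x (σ ⟨$⟩ˡ i₀)) ⟩
      0ℚ                      ∎)

zero-of-multiple : ∀ {n} {x y : Fin n → ℚ} {d} → (∀ i → y i ≡ d * x i) → NonZeroVec y →
                   ∀ {i} → y i ≡ 0ℚ → x i ≡ 0ℚ
zero-of-multiple {x = x} {d = d} y≡dx (i₀ , yi₀≢0) {i} yi≡0
  with p*q≡0⇒p≡0∨q≡0 d (x i) (trans (sym (y≡dx i)) yi≡0)
... | inj₂ xi≡0 = xi≡0
... | inj₁ d≡0  =
  ⊥-elim (yi₀≢0 (trans (y≡dx i₀) (trans (cong (_* x i₀) d≡0) (ℚ.*-zeroˡ (x i₀)))))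

module ZeroOnAnOrbit
  {n} (G : Graph n) (connected : Connected G) (quartic : Quartic G)
  {σ : Permutation′ n} (σ-aut : IsAutomorphism G σ)
  {m : ℕ} {u v : Fin n} (orbits : TwoOrbits σ m u v)
  {x : Fin n → ℚ} (x-eigen : Eigenvector0 G x) (simple : SpansKernel G x)
  {l : ℚ} (l≢0 : l ≢ 0ℚ) (x∘σ≡l*x : ∀ i → x (σ ⟨$⟩ʳ i) ≡ l * x i)
  (xu≡0 : x u ≡ 0ℚ)
  where

  open TwoOrbits orbits

  v-periodic : iter σ m v ≡ v
  v-periodic = proj₁ (proj₂ orbit-v)

  x-iter : ∀ k w → x (iter σ k w) ≡ l ^ k * x w
  x-iter = iter-eigen σ x l x∘σ≡l*x

  x-orbit-u : ∀ k → x (iter σ k u) ≡ 0ℚ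
  x-orbit-u k = iter-eigen-≡0 σ x l x∘σ≡l*x k xu≡0

  c : ℚ
  c = x v

  c≢0 : c ≢ 0ℚ
  c≢0 c≡0 with proj₁ x-eigen
  ... | i₀ , xi₀≢0 with cover i₀
  ...   | inj₁ (k , u→i₀) = xi₀≢0 (trans (cong x (sym u→i₀)) (x-orbit-u k))
  ...   | inj₂ (k , v→i₀) = xi₀≢0 (trans (cong x (sym v→i₀)) (iter-eigen-≡0 σ x l x∘σ≡l*x k c≡0))

  -c≢0 : - c ≢ 0ℚ
  -c≢0 -c≡0 = c≢0 (ℚ.neg-injective -c≡0)

  c≢-c : c ≢ - c
  c≢-c = c≢0 ∘ p≡-p⇒p≡0

  x-orbit-v≢0 : ∀ k → x (iter σ k v) ≢ 0ℚ
  x-orbit-v≢0 k = c≢0 ∘ iter-eigen-≡0⁻¹ σ x l≢0 x∘σ≡l*x k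

  l-sign : IsSign l
  l-sign = ^≡1⇒sign l (proj₁ orbit-v) (*-cancelʳ-≢0 c c≢0 (begin
    l ^ m * c       ≡⟨ x-iter m v ⟨
    x (iter σ m v)  ≡⟨ cong x v-periodic ⟩
    c               ≡⟨ ℚ.*-identityˡ c ⟨
    1ℚ * c          ∎))

  x-values : ∀ w → x w ≡ 0ℚ ⊎ x w ≡ c ⊎ x w ≡ - c
  x-values w with cover w
  ... | inj₁ (k , u→w) = inj₁ (trans (cong x (sym u→w)) (x-orbit-u k))
  ... | inj₂ (k , v→w) = inj₂ (Sum.map (trans xw≡lᵏc) (trans xw≡lᵏc) (sign*p≡±p (sign-^ l-sign k) c))
    where xw≡lᵏc = trans (cong x (sym v→w)) (x-iter k v)

  Takes : ℚ → Fin n → Bool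
  Takes d w = does (x w ℚ.≟ d)

  Takes-true : ∀ {d w} → x w ≡ d → Takes d w ≡ true
  Takes-true {d} {w} = dec-true (x w ℚ.≟ d)

  Takes-false : ∀ {d w} → x w ≢ d → Takes d w ≡ false
  Takes-false {d} {w} = dec-false (x w ℚ.≟ d)

  Takes-true⁻¹ : ∀ {d w} → Takes d w ≡ true → x w ≡ d
  Takes-true⁻¹ {d} {w} eq with x w ℚ.≟ d | eq
  ... | yes xw≡d | _  = xw≡d
  ... | no  _    | ()

  Takes-false⁻¹ : ∀ {d w} → Takes d w ≡ false → x w ≢ d
  Takes-false⁻¹ {d} {w} eq with x w ℚ.≟ d | eq
  ... | yes _    | ()
  ... | no  xw≢d | _  = xw≢d

  Zero Nonzero : Fin n → Bool
  Zero    = Takes 0ℚ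
  Nonzero = not ∘ Zero

  Zero-σ : ∀ w → Zero (σ ⟨$⟩ʳ w) ≡ Zero w
  Zero-σ w with x w ℚ.≟ 0ℚ
  ... | yes xw≡0 = Takes-true (iter-eigen-≡0 σ x l x∘σ≡l*x 1 xw≡0)
  ... | no  xw≢0 = Takes-false (xw≢0 ∘ iter-eigen-≡0⁻¹ σ x l≢0 x∘σ≡l*x 1)

  Zero-orbit-u : ∀ k → Zero (iter σ k u) ≡ true
  Zero-orbit-u k = Takes-true (x-orbit-u k)

  Zero-orbit-v : ∀ k → Zero (iter σ k v) ≡ false
  Zero-orbit-v k = Takes-false (x-orbit-v≢0 k)

  Nonzero⇒orbit-v : ∀ {w} → Nonzero w ≡ true → InOrbit σ v w
  Nonzero⇒orbit-v {w} Nonzero[w] with cover w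
  ... | inj₂ v→w       = v→w
  ... | inj₁ (k , u→w) = ⊥-elim (Takes-false⁻¹ Zero[w]≡false (trans (cong x (sym u→w)) (x-orbit-u k)))
    where Zero[w]≡false = trans (sym (not-involutive (Zero w))) (cong not Nonzero[w])

  degreeIn-orbit-v : ∀ (P : Fin n → Bool) → (∀ j → P (σ ⟨$⟩ʳ j) ≡ P j) →
                     ∀ {w} → Nonzero w ≡ true → degreeIn G P w ≡ degreeIn G P v
  degreeIn-orbit-v P P-invariant {w} Nonzero[w] with Nonzero⇒orbit-v {w} Nonzero[w]
  ... | k , refl = iter-invariant σ (degreeIn G P) (degreeIn-σ G σ σ-aut P P-invariant) k v

  classify : ∀ j → (x j ≡ 0ℚ × Zero j ≡ true  × Takes c j ≡ false × Takes (- c) j ≡ false)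
                 ⊎ (x j ≡ c   × Zero j ≡ false × Takes c j ≡ true  × Takes (- c) j ≡ false)
                 ⊎ (x j ≡ - c × Zero j ≡ false × Takes c j ≡ false × Takes (- c) j ≡ true)
  classify j with x-values j
  ... | inj₁ xj≡0 = inj₁ (xj≡0 , Takes-true xj≡0
    , Takes-false (subst (_≢ c) (sym xj≡0) (c≢0 ∘ sym))
    , Takes-false (subst (_≢ - c) (sym xj≡0) (-c≢0 ∘ sym)))
  ... | inj₂ (inj₁ xj≡c) = inj₂ (inj₁ (xj≡c
    , Takes-false (subst (_≢ 0ℚ) (sym xj≡c) c≢0)
    , Takes-true xj≡c
    , Takes-false (subst (_≢ - c) (sym xj≡c) c≢-c)))
  ... | inj₂ (inj₂ xj≡-c) = inj₂ (inj₂ (xj≡-c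
    , Takes-false (subst (_≢ 0ℚ) (sym xj≡-c) -c≢0)
    , Takes-false (subst (_≢ c) (sym xj≡-c) (c≢-c ∘ sym))
    , Takes-true xj≡-c))

  Nonzero≡Takes[c]∨Takes[-c] : ∀ j → Nonzero j ≡ Takes c j ∨ Takes (- c) j
  Nonzero≡Takes[c]∨Takes[-c] j with classify j
  ... | inj₁ (_ , is0 , isc , is-c)        rewrite is0 | isc | is-c = refl
  ... | inj₂ (inj₁ (_ , is0 , isc , _))    rewrite is0 | isc = refl
  ... | inj₂ (inj₂ (_ , is0 , isc , is-c)) rewrite is0 | isc | is-c = refl

  p q : ℕ
  p = degreeIn G (Takes c) v
  q = degreeIn G (Takes (- c)) v

  p≡q : p ≡ q
  p≡q = ×ℚ-cancelʳ-≢0 c≢0 p q (begin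
    p ×ℚ c
      ≡⟨ sum-if ℚ.+-0-monoid (λ j → adj G v j ∧ Takes c j) c ⟨
    ∑ℚ.sum (λ j → if adj G v j ∧ Takes c j then c else 0ℚ)
      ≡⟨ ∑ℚ.sum-cong-≗ balance ⟨
    ∑ℚ.sum (λ j → (if adj G v j then x j else 0ℚ) + minus j)
      ≡⟨ ∑ℚ.∑-distrib-+ (λ j → if adj G v j then x j else 0ℚ) minus ⟩
    ∑ℚ.sum (λ j → if adj G v j then x j else 0ℚ) + ∑ℚ.sum minus
      ≡⟨ cong₂ _+_ (trans (sym (applyA≡sum G x v)) (proj₂ x-eigen v))
                   (sum-if ℚ.+-0-monoid (λ j → adj G v j ∧ Takes (- c) j) c) ⟩
    0ℚ + q ×ℚ c
      ≡⟨ ℚ.+-identityˡ (q ×ℚ c) ⟩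
    q ×ℚ c
      ∎)
    where
    minus : Fin n → ℚ
    minus j = if adj G v j ∧ Takes (- c) j then c else 0ℚ
    balance : ∀ j → (if adj G v j then x j else 0ℚ) + minus j ≡ (if adj G v j ∧ Takes c j then c else 0ℚ)
    balance j with adj G v j | classify j
    ... | false | _ = ℚ.+-identityˡ 0ℚ
    ... | true  | inj₁ (xj≡0 , _ , isc , is-c)
      rewrite isc | is-c = trans (ℚ.+-identityʳ (x j)) xj≡0
    ... | true  | inj₂ (inj₁ (xj≡c , _ , isc , is-c))
      rewrite isc | is-c = trans (ℚ.+-identityʳ (x j)) xj≡c
    ... | true  | inj₂ (inj₂ (xj≡-c , _ , isc , is-c))
      rewrite isc | is-c = trans (cong (_+ c) xj≡-c) (ℚ.+-inverseˡ c)

  degreeIn-Nonzero-v : degreeIn G Nonzero v ≡ 2 ℕ.* p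
  degreeIn-Nonzero-v = begin
    degreeIn G Nonzero v
      ≡⟨ count-cong (λ j → cong (adj G v j ∧_) (Nonzero≡Takes[c]∨Takes[-c] j)) ⟩
    degreeIn G (λ j → Takes c j ∨ Takes (- c) j) v
      ≡⟨ degreeIn-∨ G (Takes c) (Takes (- c)) exclusive v ⟩
    p ℕ.+ q
      ≡⟨ cong (p ℕ.+_) (trans (ℕ.*-identityˡ p) p≡q) ⟨
    2 ℕ.* p
      ∎
    where
    exclusive : ∀ j → Takes c j ∧ Takes (- c) j ≡ false
    exclusive j with classify j
    ... | inj₁ (_ , _ , isc , _)           rewrite isc = refl
    ... | inj₂ (inj₁ (_ , _ , isc , is-c)) rewrite isc | is-c = refl
    ... | inj₂ (inj₂ (_ , _ , isc , _))    rewrite isc = refl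

  degree-v : degreeIn G Zero v ℕ.+ 2 ℕ.* p ≡ 4
  degree-v = begin
    degreeIn G Zero v ℕ.+ 2 ℕ.* p               ≡⟨ cong (degreeIn G Zero v ℕ.+_) degreeIn-Nonzero-v ⟨
    degreeIn G Zero v ℕ.+ degreeIn G Nonzero v  ≡⟨ degreeIn+degreeIn-complement G Zero v ⟩
    degree G v                                  ≡⟨ quartic v ⟩
    4                                           ∎

  disconnected-case : degreeIn G Zero v ≡ 0 → ⊥
  disconnected-case degreeIn-Zero-v≡0 =
    closed-under-walks G (λ w → x w ≢ 0ℚ) closed (connected v u) c≢0 xu≡0
    where
    closed : ∀ {i j} → adj G i j ≡ true → x i ≢ 0ℚ → x j ≢ 0ℚ
    closed {i} ij xi≢0 = Takes-false⁻¹ (degreeIn≡0⇒false G Zero degreeIn-Zero-i≡0 ij)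
      where
      degreeIn-Zero-i≡0 =
        trans (degreeIn-orbit-v Zero Zero-σ {i} (cong not (Takes-false xi≢0))) degreeIn-Zero-v≡0

  unique-nbr : ∀ {d} → degreeIn G (Takes d) v ≡ 1 →
               ∃[ a ] adj G v a ≡ true × x a ≡ d × (∀ {b} → adj G v b ≡ true → x b ≡ x a → b ≡ a)
  unique-nbr {d} count≡1
    with count≢0⇒∃ (λ j → adj G v j ∧ Takes d j) (ℕ.1+n≢0 ∘ trans (sym count≡1))
  ... | a , va∧Takes[d]a with ∧-true (adj G v a) (Takes d a) va∧Takes[d]a
  ...   | va , Takes[d]a = a , va , Takes-true⁻¹ Takes[d]a , λ vb xb≡xa →
    count≡1⇒unique _ count≡1
      (cong₂ _∧_ vb (Takes-true (trans xb≡xa (Takes-true⁻¹ Takes[d]a)))) va∧Takes[d]a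

  -- σ^(m-s) carries the edge v — σˢ v to the edge σ^(m-s) v — v, and l^(m-s) is its own inverse.
  mirror : ∀ {s a} → s ℕ.≤ m → iter σ s v ≡ a → adj G v a ≡ true →
           adj G v (iter σ (m ∸ s) v) ≡ true × x (iter σ (m ∸ s) v) ≡ x a
  mirror {s} {a} s≤m vˢ≡a va = v-mirror , x-mirror
    where
    s' = m ∸ s
    σˢ'a≡v : iter σ s' a ≡ v
    σˢ'a≡v = begin
      iter σ s' a             ≡⟨ cong (iter σ s') vˢ≡a ⟨
      iter σ s' (iter σ s v)  ≡⟨ iter-+ σ s' s v ⟨
      iter σ (s' ℕ.+ s) v     ≡⟨ cong (λ t → iter σ t v) (ℕ.m∸n+n≡m s≤m) ⟩
      iter σ m v              ≡⟨ v-periodic ⟩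
      v                       ∎
    v-mirror : adj G v (iter σ s' v) ≡ true
    v-mirror = begin
      adj G v (iter σ s' v)              ≡⟨ symmetric G v (iter σ s' v) ⟩
      adj G (iter σ s' v) v              ≡⟨ cong (adj G (iter σ s' v)) σˢ'a≡v ⟨
      adj G (iter σ s' v) (iter σ s' a)  ≡⟨ adj-iter G σ σ-aut s' v a ⟩
      adj G v a                          ≡⟨ va ⟩
      true                               ∎
    x-mirror : x (iter σ s' v) ≡ x a
    x-mirror = begin
      x (iter σ s' v)           ≡⟨ x-iter s' v ⟩
      l ^ s' * x v              ≡⟨ cong (λ w → l ^ s' * x w) σˢ'a≡v ⟨
      l ^ s' * x (iter σ s' a)  ≡⟨ cong (l ^ s' *_) (x-iter s' a) ⟩
      l ^ s' * (l ^ s' * x a)   ≡⟨ ℚ.*-assoc (l ^ s') (l ^ s') (x a) ⟨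
      l ^ s' * l ^ s' * x a     ≡⟨ cong (_* x a) (sign*sign≡1 (sign-^ l-sign s')) ⟩
      1ℚ * x a                  ≡⟨ ℚ.*-identityˡ (x a) ⟩
      x a                       ∎

  antipode : ∀ {a} → adj G v a ≡ true → x a ≢ 0ℚ →
             (∀ {b} → adj G v b ≡ true → x b ≡ x a → b ≡ a) → ∃[ s ] 2 ℕ.* s ≡ m × iter σ s v ≡ a
  antipode {a} va xa≢0 unique =
    s , half-period (ℕ.n≢0⇒n>0 s≢0) s<m (orbitSize-∣ σ orbit-v 2s-period) , vˢ≡a
    where
    instance _ = ℕ.>-nonZero (proj₁ orbit-v)
    v→a = Nonzero⇒orbit-v {a} (cong not (Takes-false xa≢0))
    s = proj₁ v→a % m
    s<m = m%n<n (proj₁ v→a) m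
    vˢ≡a : iter σ s v ≡ a
    vˢ≡a = trans (iter-% σ v-periodic (proj₁ v→a)) (proj₂ v→a)
    s≢0 : s ≢ 0
    s≢0 s≡0 with () ← trans (sym (irreflexive G v))
                        (trans (cong (λ t → adj G v (iter σ t v)) (sym s≡0)) (trans (cong (adj G v) vˢ≡a) va))
    mirror≡a : iter σ (m ∸ s) v ≡ a
    mirror≡a = let v-mirror , x-mirror = mirror (ℕ.<⇒≤ s<m) vˢ≡a va in unique v-mirror x-mirror
    2s-period : iter σ (2 ℕ.* s) v ≡ v
    2s-period = begin
      iter σ (s ℕ.+ 1 ℕ.* s) v       ≡⟨ iter-+ σ s (1 ℕ.* s) v ⟩
      iter σ s (iter σ (1 ℕ.* s) v)  ≡⟨ cong (λ t → iter σ s (iter σ t v)) (ℕ.*-identityˡ s) ⟩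
      iter σ s (iter σ s v)          ≡⟨ cong (iter σ s) (trans vˢ≡a (sym mirror≡a)) ⟩
      iter σ s (iter σ (m ∸ s) v)    ≡⟨ iter-+ σ s (m ∸ s) v ⟨
      iter σ (s ℕ.+ (m ∸ s)) v       ≡⟨ cong (λ t → iter σ t v) (ℕ.m+[n∸m]≡n (ℕ.<⇒≤ s<m)) ⟩
      iter σ m v                     ≡⟨ v-periodic ⟩
      v                              ∎

  antipodal-case : p ≡ 1 → ⊥
  antipodal-case p≡1
    with unique-nbr {c} p≡1 | unique-nbr { - c} (trans (sym p≡q) p≡1)
  ... | a₊ , va₊ , xa₊≡c , unique₊ | a₋ , va₋ , xa₋≡-c , unique₋
    with antipode va₊ (subst (_≢ 0ℚ) (sym xa₊≡c) c≢0) unique₊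
       | antipode va₋ (subst (_≢ 0ℚ) (sym xa₋≡-c) -c≢0) unique₋
  ... | s₊ , 2s₊≡m , vˢ₊≡a₊ | s₋ , 2s₋≡m , vˢ₋≡a₋ = c≢-c (begin
    c                ≡⟨ xa₊≡c ⟨
    x a₊             ≡⟨ cong x vˢ₊≡a₊ ⟨
    x (iter σ s₊ v)  ≡⟨ cong (λ s → x (iter σ s v)) s₊≡s₋ ⟩
    x (iter σ s₋ v)  ≡⟨ cong x vˢ₋≡a₋ ⟩
    x a₋             ≡⟨ xa₋≡-c ⟩
    - c              ∎)
    where s₊≡s₋ = ℕ.*-cancelˡ-≡ s₊ s₋ 2 (trans 2s₊≡m (sym 2s₋≡m))

  -- v has no neighbour in its own orbit, so the graph is bipartite between the two orbits.  Then
  -- y = x ∘ swap is a kernel vector: Ay vanishes on the orbit of u, whose neighbours all lie in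
  -- the orbit of v where y = 0; on the orbit of v, Ay · x is σ-invariant (l² = 1), hence
  -- constant, while it sums to ⟨Ay , x⟩ = ⟨y , Ax⟩ = 0.
  module BipartiteCase (degreeIn-Nonzero-v≡0 : degreeIn G Nonzero v ≡ 0) where

    Nonzero-independent : Independent G Nonzero
    Nonzero-independent w Nonzero[w] =
      trans (degreeIn-orbit-v Nonzero (cong not ∘ Zero-σ) {w} Nonzero[w]) degreeIn-Nonzero-v≡0

    Zero∘swap≡Nonzero : ∀ w → Zero (swap-fun w) ≡ Nonzero w
    Zero∘swap≡Nonzero w = Sum.[ on-orbit-u , on-orbit-v ]′ (cover w)
      where
      on-orbit-u : ∀ {w} → InOrbit σ u w → Zero (swap-fun w) ≡ Nonzero w
      on-orbit-u (k , refl) =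
        trans (cong Zero (swap-u k)) (trans (Zero-orbit-v k) (sym (cong not (Zero-orbit-u k))))
      on-orbit-v : ∀ {w} → InOrbit σ v w → Zero (swap-fun w) ≡ Nonzero w
      on-orbit-v (k , refl) =
        trans (cong Zero (swap-v k)) (trans (Zero-orbit-u k) (sym (cong not (Zero-orbit-v k))))

    |Zero|≡|Nonzero| : count Zero ≡ count Nonzero
    |Zero|≡|Nonzero| = trans (count-permute Zero swap) (count-cong Zero∘swap≡Nonzero)

    Zero-independent : Independent G Zero
    Zero-independent = regular-balanced-independent G Zero quartic |Zero|≡|Nonzero| Nonzero-independent

    y : Fin n → ℚ
    y = x ∘ swap-fun

    y∘σ≡l*y : ∀ w → y (σ ⟨$⟩ʳ w) ≡ l * y w
    y∘σ≡l*y w = trans (cong x (swap-σ w)) (x∘σ≡l*x (swap-fun w))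

    y-on-Nonzero : ∀ {w} → Nonzero w ≡ true → y w ≡ 0ℚ
    y-on-Nonzero {w} Nonzero[w] with Nonzero⇒orbit-v {w} Nonzero[w]
    ... | k , refl = trans (cong x (swap-v k)) (x-orbit-u k)

    Ay-on-Zero : ∀ {w} → Zero w ≡ true → applyA G y w ≡ 0ℚ
    Ay-on-Zero {w} Zero[w] =
      trans (applyA≡sum G y w) (trans (∑ℚ.sum-cong-≗ no-Zero-nbr) (∑ℚ.sum-replicate-zero n))
      where
      no-Zero-nbr : ∀ j → (if adj G w j then y j else 0ℚ) ≡ 0ℚ
      no-Zero-nbr j with adj G w j in wj
      ... | true  = y-on-Nonzero (cong not (degreeIn≡0⇒false G Zero (Zero-independent w Zero[w]) wj))
      ... | false = refl

    Ay∘σ≡l*Ay : ∀ w → applyA G y (σ ⟨$⟩ʳ w) ≡ l * applyA G y w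
    Ay∘σ≡l*Ay = applyA-eigen G σ σ-aut y l y∘σ≡l*y

    g : Fin n → ℚ
    g w = applyA G y w * x w

    g-σ : ∀ w → g (σ ⟨$⟩ʳ w) ≡ g w
    g-σ w = begin
      applyA G y (σ ⟨$⟩ʳ w) * x (σ ⟨$⟩ʳ w)  ≡⟨ cong₂ _*_ (Ay∘σ≡l*Ay w) (x∘σ≡l*x w) ⟩
      (l * applyA G y w) * (l * x w)         ≡⟨ interchange l (applyA G y w) l (x w) ⟩
      (l * l) * g w                          ≡⟨ cong (_* g w) (sign*sign≡1 l-sign) ⟩
      1ℚ * g w                               ≡⟨ ℚ.*-identityˡ (g w) ⟩
      g w                                    ∎

    g≡if-Nonzero : ∀ w → g w ≡ (if Nonzero w then g v else 0ℚ)
    g≡if-Nonzero w with Zero w in Zero[w]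
    ... | true  = trans (cong (applyA G y w *_) (Takes-true⁻¹ Zero[w])) (ℚ.*-zeroʳ (applyA G y w))
    ... | false with Nonzero⇒orbit-v {w} (cong not Zero[w])
    ...   | k , refl = iter-invariant σ g g-σ k v

    gv≡0 : g v ≡ 0ℚ
    gv≡0 = n×ℚp≡0⇒p≡0 (count-pos Nonzero {v} (cong not (Zero-orbit-v 0))) (begin
      count Nonzero ×ℚ g v                          ≡⟨ sum-if ℚ.+-0-monoid Nonzero (g v) ⟨
      ∑ℚ.sum (λ w → if Nonzero w then g v else 0ℚ)  ≡⟨ ∑ℚ.sum-cong-≗ g≡if-Nonzero ⟨
      ∑ℚ.sum g                                      ≡⟨ applyA-self-adjoint G y x ⟩
      ∑ℚ.sum (λ w → y w * applyA G x w)             ≡⟨ ∑ℚ.sum-cong-≗ y*Ax≡0 ⟩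
      ∑ℚ.sum {n} (λ _ → 0ℚ)                         ≡⟨ ∑ℚ.sum-replicate-zero n ⟩
      0ℚ                                            ∎)
      where
      y*Ax≡0 : ∀ w → y w * applyA G x w ≡ 0ℚ
      y*Ax≡0 w = trans (cong (y w *_) (proj₂ x-eigen w)) (ℚ.*-zeroʳ (y w))

    Ayv≡0 : applyA G y v ≡ 0ℚ
    Ayv≡0 with p*q≡0⇒p≡0∨q≡0 (applyA G y v) c gv≡0
    ... | inj₁ Ayv≡0 = Ayv≡0
    ... | inj₂ c≡0   = ⊥-elim (c≢0 c≡0)

    y-kernel : InKernel G y
    y-kernel w with Zero w in Zero[w]
    ... | true  = Ay-on-Zero Zero[w]
    ... | false with Nonzero⇒orbit-v {w} (cong not Zero[w])
    ...   | k , refl = iter-eigen-≡0 σ (applyA G y) l Ay∘σ≡l*Ay k Ayv≡0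

    absurd : ⊥
    absurd with simple y y-kernel
    ... | d , y≡dx = c≢0 (begin
      c        ≡⟨ cong x (swap-u 0) ⟨
      y u      ≡⟨ y≡dx u ⟩
      d * x u  ≡⟨ cong (d *_) xu≡0 ⟩
      d * 0ℚ   ≡⟨ ℚ.*-zeroʳ d ⟩
      0ℚ       ∎)

  p≤2 : p ℕ.≤ 2
  p≤2 = ℕ.*-cancelˡ-≤ 2 (subst (2 ℕ.* p ℕ.≤_) degree-v (ℕ.m≤n+m (2 ℕ.* p) (degreeIn G Zero v)))

  absurd : ⊥
  absurd with p in p≡ | p≤2
  ... | 0 | _ = BipartiteCase.absurd (trans degreeIn-Nonzero-v (cong (2 ℕ.*_) p≡))
  ... | 1 | _ = antipodal-case p≡
  ... | 2 | _ = disconnected-case (ℕ.+-cancelʳ-≡ 4 (degreeIn G Zero v) 0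
                  (trans (cong (λ t → degreeIn G Zero v ℕ.+ 2 ℕ.* t) (sym p≡)) degree-v))
  ... | suc (suc (suc _)) | s≤s (s≤s ())

lemma2p4 : ∀ {n} (G : Graph n) → Connected G → Quartic G → Bicirculant G →
           SimpleEigenvalue0 G →
           ∀ (x : Fin n → ℚ) → Eigenvector0 G x → ∀ i → x i ≢ 0ℚ
lemma2p4 G connected quartic (m , _ , σ , σ-aut , u , v , orbit-u , orbit-v , u↛v , cover)
         (x₀ , x₀-eigen , simple) x (x≢0 , x-kernel) i xi≡0
  with spansKernel⇒σ-eigen G σ σ-aut x₀ x₀-eigen simple | simple x x-kernel
... | l , l≢0 , x₀∘σ≡l*x₀ | d , x≡dx₀ =
  Sum.[ (λ (k , u→i) → zero-at-representative orbits (x₀-vanishes k u→i))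
      , (λ (k , v→i) → zero-at-representative (TwoOrbits.flip orbits) (x₀-vanishes k v→i))
      ]′ (cover i)
  where
  orbits : TwoOrbits σ m u v
  orbits = record { orbit-u = orbit-u ; orbit-v = orbit-v ; disjoint = u↛v ; cover = cover }
  x₀-vanishes : ∀ {w} k → iter σ k w ≡ i → x₀ w ≡ 0ℚ
  x₀-vanishes k w→i = iter-eigen-≡0⁻¹ σ x₀ l≢0 x₀∘σ≡l*x₀ k
    (trans (cong x₀ w→i) (zero-of-multiple {x = x₀} {d = d} x≡dx₀ x≢0 xi≡0))
  zero-at-representative : ∀ {a b} → TwoOrbits σ m a b → x₀ a ≡ 0ℚ → ⊥
  zero-at-representative orbits' =
    ZeroOnAnOrbit.absurd G connected quartic σ-aut orbits' x₀-eigen simple l≢0 x₀∘σ≡l*x₀
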